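{- Let $P$ be a permutation of $\{1,\ldots,n\}$ and let $D=\{a,\ldots,b\}\subseteq\{1,\ldots,n\}$ be an integer interval. Let $S_1,\ldots,S_m$ be nonempty integer intervals partitioning $D$, listed from left to right (every element of $S_i$ is smaller than every element of $S_{i+1}$), such that each $S_i\in\mathcal{C}(D)$, and such that there are no $1\le i<j\le m$ with $S_i\cup S_{i+1}\cup\cdots\cup S_j\in\mathcal{C}(D)$. Then the set of overlap-free members of $\mathcal{C}(D)$ is exactly $\bigcup_{i=1}^m \mathcal{O}(S_i)$, where $\mathcal{O}(S_i)$ is the set of overlap-free members of $\mathcal{C}(S_i)$; i.e. the forest formed by the decomposition trees of $P$ restricted to $S_1,\ldots,S_m$ is the decomposition forest of $P$ restricted to $D$.
   Context: For an integer interval $E\subseteq\{1,\ldots,n\}$, $\mathcal{C}(E)$ denotes the set of nonempty integer intervals $I\subseteq E$ such that $P(I)=\{P(z):z\in I\}$ is a set of consecutive integers (a connected interval). Two sets overlap if they intersect and neither contains the other. A member of $\mathcal{C}(E)$ is overlap-free if it overlaps no other member of $\mathcal{C}(E)$. The overlap-free members form a laminar family; the decomposition tree (or forest) of $P$ restricted to $E$ is this laminar family ordered by inclusion, the parent of a member being the smallest overlap-free member strictly containing it. -}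

module Defs where

open import Data.Nat using (ℕ)
open import Data.Fin using (Fin; _≤_; _<_)
open import Data.Fin.Permutation using (Permutation′; _⟨$⟩ʳ_)
open import Data.Product using (Σ; _×_; ∃; ∃-syntax)
open import Relation.Nullary using (¬_)

-- Positions and values are 0-based: {1,…,n} is modelled by Fin n.

record Interval (n : ℕ) : Set where
  constructor [_,_]⟨_⟩
  field
    lo   : Fin n
    hi   : Fin n
    lo≤hi : lo ≤ hi
open Interval public

_∈I_ : {n : ℕ} → Fin n → Interval n → Set
z ∈I I = (lo I ≤ z) × (z ≤ hi I)

_⊆I_ : {n : ℕ} → Interval n → Interval n → Set
I ⊆I J = ∀ z → z ∈I I → z ∈I J

ImageConsecutive : {n : ℕ} → Permutation′ n → Interval n → Set
ImageConsecutive P I =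
  ∀ x y v → x ∈I I → y ∈I I → (P ⟨$⟩ʳ x) ≤ v → v ≤ (P ⟨$⟩ʳ y) →
    ∃[ z ] (z ∈I I × (P ⟨$⟩ʳ z) ≡ v)
  where open import Relation.Binary.PropositionalEquality using (_≡_)

-- I ∈ 𝒞(E)  (nonemptiness is built into Interval)
InC : {n : ℕ} → Permutation′ n → Interval n → Interval n → Set
InC P E I = I ⊆I E × ImageConsecutive P I

Overlap : {n : ℕ} → Interval n → Interval n → Set
Overlap I J = (∃[ z ] (z ∈I I × z ∈I J)) × ¬ (I ⊆I J) × ¬ (J ⊆I I)

OverlapFree : {n : ℕ} → Permutation′ n → Interval n → Interval n → Set
OverlapFree P E I = InC P E I × (∀ J → InC P E J → ¬ Overlap I J)

module Submission where

-- The key fact is that, under the hypotheses on the blocks S₁ < … < Sₘ,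
-- every member J of 𝒞(D) lies inside a single block.  If instead J started
-- in Sₐ and ended in S_b with a < b, then Sₐ ∪ J ∪ S_b = Sₐ ∪ … ∪ S_b, and
-- a union of two common intervals that intersect is again a common interval
-- (hullConsecutive), so Sₐ ∪ … ∪ S_b ∈ 𝒞(D), which is excluded.
--
-- Hence 𝒞(D) = ⋃ᵢ 𝒞(Sᵢ).  An overlap-free member of 𝒞(D) lies in some Sᵢ and
-- overlaps nothing in the smaller family 𝒞(Sᵢ).  Conversely, a member J of
-- 𝒞(D) overlapping I ∈ 𝒞(Sᵢ) intersects Sᵢ and lies in one block, which must
-- be Sᵢ since the blocks are disjoint; so J ∈ 𝒞(Sᵢ).

open import Defs
open import Data.Nat using (ℕ)
open import Data.Fin using (Fin; _≤_; _<_)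
open import Data.Fin.Permutation using (Permutation′; _⟨$⟩ʳ_)
open import Data.Product using (_×_; ∃-syntax; Σ-syntax; _,_; proj₁; proj₂)
open import Function.Bundles using (_⇔_; mk⇔; Equivalence)
open import Relation.Nullary using (¬_; Dec; yes; no)
open import Relation.Binary.PropositionalEquality using (_≡_; refl)
open import Data.Empty using (⊥-elim)
import Data.Nat.Properties as ℕ
import Data.Fin.Properties as F

module _ {n : ℕ} where

  lo∈ : (I : Interval n) → lo I ∈I I
  lo∈ I = ℕ.≤-refl , lo≤hi I

  hi∈ : (I : Interval n) → hi I ∈I I
  hi∈ I = lo≤hi I , ℕ.≤-refl

  endpoints⇒⊆ : (I J : Interval n) → lo I ∈I J → hi I ∈I J → I ⊆I J
  endpoints⇒⊆ I J lo∈J hi∈J z (lo≤z , z≤hi) =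
    ℕ.≤-trans (proj₁ lo∈J) lo≤z , ℕ.≤-trans z≤hi (proj₂ hi∈J)

  InC-mono : {P : Permutation′ n} {E F J : Interval n} → E ⊆I F → InC P E J → InC P F J
  InC-mono E⊆F (J⊆E , J-consec) = (λ z z∈J → E⊆F z (J⊆E z z∈J)) , J-consec

  hull : (I J : Interval n) → hi I ≤ hi J → Interval n
  hull I J hiI≤hiJ = [ lo I , hi J ]⟨ ℕ.≤-trans (lo≤hi I) hiI≤hiJ ⟩

  -- If J starts inside I and ends after I, then [lo I, hi J] = I ∪ J, and
  -- this union of two common intervals is a common interval: a value v
  -- between P x and P y is reached inside the part containing x if
  -- v ≤ P (lo J), and inside the part containing y otherwise, since the
  -- common point lo J belongs to both parts.
  hullConsecutive : (P : Permutation′ n) (I J : Interval n) →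
    ImageConsecutive P I → ImageConsecutive P J →
    (loI≤loJ : lo I ≤ lo J) → lo J ≤ hi I → (hiI≤hiJ : hi I ≤ hi J) →
    ImageConsecutive P (hull I J hiI≤hiJ)
  hullConsecutive P I J I-consec J-consec loI≤loJ loJ≤hiI hiI≤hiJ x y v x∈H y∈H Px≤v v≤Py =
    bySide (v F.≤? (P ⟨$⟩ʳ lo J))
    where
    H : Interval n
    H = hull I J hiI≤hiJ

    I⊆H : I ⊆I H
    I⊆H = endpoints⇒⊆ I H (ℕ.≤-refl , ℕ.≤-trans (lo≤hi I) hiI≤hiJ) (lo≤hi I , hiI≤hiJ)

    J⊆H : J ⊆I H
    J⊆H = endpoints⇒⊆ J H (loI≤loJ , lo≤hi J) (ℕ.≤-trans loI≤loJ (lo≤hi J) , ℕ.≤-refl)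

    w∈I : lo J ∈I I
    w∈I = loI≤loJ , loJ≤hiI

    -- A point z of H lies in I (if z ≤ hi I) or in J (otherwise), and so does
    -- lo J; a value reachable inside any common interval X containing z and
    -- lo J is therefore reachable inside H.
    reach : ∀ {z} → z ∈I H →
      (∀ {X} → ImageConsecutive P X → z ∈I X → lo J ∈I X → ∃[ u ] (u ∈I X × (P ⟨$⟩ʳ u) ≡ v)) →
      ∃[ u ] (u ∈I H × (P ⟨$⟩ʳ u) ≡ v)
    reach {z} (loI≤z , z≤hiJ) found with z F.≤? hi I
    ... | yes z≤hiI with found {I} I-consec (loI≤z , z≤hiI) w∈I
    ...   | u , u∈I , Pu≡v = u , I⊆H u u∈I , Pu≡v
    reach {z} (loI≤z , z≤hiJ) found | no z≰hiI
      with found {J} J-consec (ℕ.≤-trans loJ≤hiI (ℕ.<⇒≤ (ℕ.≰⇒> z≰hiI)) , z≤hiJ) (lo∈ J)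
    ...   | u , u∈J , Pu≡v = u , J⊆H u u∈J , Pu≡v

    bySide : Dec (v ≤ (P ⟨$⟩ʳ lo J)) → ∃[ u ] (u ∈I H × (P ⟨$⟩ʳ u) ≡ v)
    bySide (yes v≤Pw) = reach x∈H (λ X-consec x∈X w∈X → X-consec x (lo J) v x∈X w∈X Px≤v v≤Pw)
    bySide (no  v≰Pw) = reach y∈H (λ X-consec y∈X w∈X → X-consec (lo J) y v w∈X y∈X (ℕ.<⇒≤ (ℕ.≰⇒> v≰Pw)) v≤Py)

module Blocks {n : ℕ} (P : Permutation′ n) (D : Interval n)
    (m : ℕ) (S : Fin m → Interval n)
    (cover : ∀ z → z ∈I D ⇔ (∃[ i ] z ∈I S i))
    (ordered : ∀ (i j : Fin m) x y → i < j → x ∈I S i → y ∈I S j → x < y)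
    (blocks∈C : ∀ i → InC P D (S i))
    (noUnion : ∀ (i j : Fin m) → i < j → ¬ (Σ[ I ∈ Interval n ] ((∀ z → z ∈I I ⇔ (∃[ k ] ((i ≤ k) × (k ≤ j) × z ∈I S k))) × InC P D I)))
  where

  open Equivalence

  blockOf : ∀ {z} → z ∈I D → ∃[ i ] z ∈I S i
  blockOf {z} = to (cover z)

  S⊆D : ∀ i → S i ⊆I D
  S⊆D i = proj₁ (blocks∈C i)

  blockMono : ∀ {i j x y} → x ∈I S i → y ∈I S j → x ≤ y → i ≤ j
  blockMono {i} {j} x∈Si y∈Sj x≤y = ℕ.≮⇒≥ (λ j<i → ℕ.<⇒≱ (ordered j i _ _ j<i y∈Sj x∈Si) x≤y)

  blocksDisjoint : ∀ {i j z} → z ∈I S i → z ∈I S j → i ≡ j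
  blocksDisjoint z∈Si z∈Sj = F.≤-antisym (blockMono z∈Si z∈Sj ℕ.≤-refl) (blockMono z∈Sj z∈Si ℕ.≤-refl)

  lo-block≤ : ∀ {i k z} → i ≤ k → z ∈I S k → lo (S i) ≤ z
  lo-block≤ {i} {k} i≤k z∈Sk with i F.≟ k
  ... | yes refl = proj₁ z∈Sk
  ... | no  i≢k  = ℕ.<⇒≤ (ordered i k _ _ (F.≤∧≢⇒< i≤k i≢k) (lo∈ (S i)) z∈Sk)

  ≤-hi-block : ∀ {k j z} → k ≤ j → z ∈I S k → z ≤ hi (S j)
  ≤-hi-block {k} {j} k≤j z∈Sk with k F.≟ j
  ... | yes refl = proj₂ z∈Sk
  ... | no  k≢j  = ℕ.<⇒≤ (ordered k j _ _ (F.≤∧≢⇒< k≤j k≢j) z∈Sk (hi∈ (S j)))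

  Span : (a b : Fin m) → lo (S a) ≤ hi (S b) → Interval n
  Span a b p = [ lo (S a) , hi (S b) ]⟨ p ⟩

  Span⊆D : ∀ a b p → Span a b p ⊆I D
  Span⊆D a b p = endpoints⇒⊆ (Span a b p) D (S⊆D a _ (lo∈ (S a))) (S⊆D b _ (hi∈ (S b)))

  Span-members : ∀ a b p z → z ∈I Span a b p ⇔ (∃[ k ] ((a ≤ k) × (k ≤ b) × z ∈I S k))
  Span-members a b p z = mk⇔ fromSpan toSpan
    where
    fromSpan : z ∈I Span a b p → ∃[ k ] ((a ≤ k) × (k ≤ b) × z ∈I S k)
    fromSpan z∈ with blockOf (Span⊆D a b p z z∈)
    ... | k , z∈Sk = k , blockMono (lo∈ (S a)) z∈Sk (proj₁ z∈) , blockMono z∈Sk (hi∈ (S b)) (proj₂ z∈) , z∈Sk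

    toSpan : ∃[ k ] ((a ≤ k) × (k ≤ b) × z ∈I S k) → z ∈I Span a b p
    toSpan (k , a≤k , k≤b , z∈Sk) = lo-block≤ a≤k z∈Sk , ≤-hi-block k≤b z∈Sk

  -- Otherwise it starts in
  -- block a and ends in a later block b, and the span of a, …, b, being
  -- S a ∪ J ∪ S b, would be a union of consecutive blocks in 𝒞(D).
  inOneBlock : ∀ J → InC P D J → ∃[ k ] J ⊆I S k
  inOneBlock J (J⊆D , J-consec) with blockOf (J⊆D _ (lo∈ J)) | blockOf (J⊆D _ (hi∈ J))
  ... | a , loJ∈Sa | b , hiJ∈Sb with a F.≟ b
  ...   | yes refl = a , endpoints⇒⊆ J (S a) loJ∈Sa hiJ∈Sb
  ...   | no  a≢b  = ⊥-elim (noUnion a b a<b (span , Span-members a b (lo≤hi span) , Span⊆D a b (lo≤hi span) , span-consec))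
    where
    a<b : a < b
    a<b = F.≤∧≢⇒< (blockMono loJ∈Sa hiJ∈Sb (lo≤hi J)) a≢b

    hiSa≤hiJ : hi (S a) ≤ hi J
    hiSa≤hiJ = ℕ.<⇒≤ (ordered a b _ _ a<b (hi∈ (S a)) hiJ∈Sb)

    -- S a ∪ J, as the hull [lo (S a), hi J]
    SaJ : Interval n
    SaJ = hull (S a) J hiSa≤hiJ

    SaJ-consec : ImageConsecutive P SaJ
    SaJ-consec = hullConsecutive P (S a) J (proj₂ (blocks∈C a)) J-consec
      (proj₁ loJ∈Sa) (proj₂ loJ∈Sa) hiSa≤hiJ

    -- S a ∪ J ∪ S b, as the hull [lo (S a), hi (S b)]
    span : Interval n
    span = hull SaJ (S b) (proj₂ hiJ∈Sb)

    span-consec : ImageConsecutive P span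
    span-consec = hullConsecutive P SaJ (S b) SaJ-consec (proj₂ (blocks∈C b))
      (ℕ.<⇒≤ (ordered a b _ _ a<b (lo∈ (S a)) (lo∈ (S b)))) (proj₁ hiJ∈Sb) (proj₂ hiJ∈Sb)

  overlapFree-restrict : ∀ I → OverlapFree P D I → ∃[ i ] OverlapFree P (S i) I
  overlapFree-restrict I (I∈C , I-free) with inOneBlock I I∈C
  ... | i , I⊆Si = i , (I⊆Si , proj₂ I∈C) , λ J J∈CSi → I-free J (InC-mono {P = P} {S i} {D} {J} (S⊆D i) J∈CSi)

  -- An overlap-free member of 𝒞(S i) is overlap-free in 𝒞(D): anything in
  -- 𝒞(D) overlapping it lies in a block meeting S i, hence in S i itself.
  overlapFree-extend : ∀ i I → OverlapFree P (S i) I → OverlapFree P D I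
  overlapFree-extend i I (I∈CSi , I-free) = InC-mono {P = P} {S i} {D} {I} (S⊆D i) I∈CSi , noOverlap
    where
    noOverlap : ∀ J → InC P D J → ¬ Overlap I J
    noOverlap J J∈C I-overlaps-J@((z , z∈I , z∈J) , _) with inOneBlock J J∈C
    ... | k , J⊆Sk with blocksDisjoint (proj₁ I∈CSi z z∈I) (J⊆Sk z z∈J)
    ...   | refl = I-free J (J⊆Sk , proj₂ J∈C) I-overlaps-J

mainTheorem9 : (n : ℕ) (P : Permutation′ n) (D : Interval n)
    (m : ℕ) (S : Fin m → Interval n) →
    (∀ z → z ∈I D ⇔ (∃[ i ] z ∈I S i)) →
    (∀ (i j : Fin m) x y → i < j → x ∈I S i → y ∈I S j → x < y) →
    (∀ i → InC P D (S i)) →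
    (∀ (i j : Fin m) → i < j → ¬ (Σ[ I ∈ Interval n ] ((∀ z → z ∈I I ⇔ (∃[ k ] ((i ≤ k) × (k ≤ j) × z ∈I S k))) × InC P D I))) →
    ∀ I → OverlapFree P D I ⇔ (∃[ i ] OverlapFree P (S i) I)
mainTheorem9 n P D m S cover ordered blocks∈C noUnion I =
  mk⇔ (overlapFree-restrict I) (λ (i , I-free) → overlapFree-extend i I I-free)
  where open Blocks P D m S cover ordered blocks∈C noUnion
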